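{- Let $P$ be a non-empty finite set and $\mathcal{L}$ a set of formulae with semantic function $[\![\cdot]\!]:\mathcal{L}\to\mathcal{P}(P)$ such that $\mathcal{L}(p)\neq\emptyset$ for every $p\in P$, and suppose $\mathcal{L}$ features the Boolean connective $\wedge$. Then (a) $\mathcal{L}$ is finitely characterized by $\mathcal{B}$ for some monotonic $\mathcal{B}$, and (b) every formula $\phi\in\mathcal{L}$ is finitely represented.
   Context: For $p\in P$, $\mathcal{L}(p)=\{\phi\in\mathcal{L}\mid p\in[\![\phi]\!]\}$ and $\uparrow p=\{p'\in P\mid\mathcal{L}(p)\subseteq\mathcal{L}(p')\}$. "$\mathcal{L}$ features $\wedge$" means that for all $\phi,\psi\in\mathcal{L}$ there is $\phi\wedge\psi\in\mathcal{L}$ with $[\![\phi\wedge\psi]\!]=[\![\phi]\!]\cap[\![\psi]\!]$. $\mathcal{L}$ is characterized by $\mathcal{B}:P\to\mathcal{P}(\mathcal{L})$ iff for each $p\in P$: $\emptyset\subsetneq\mathcal{B}(p)\subseteq\mathcal{L}(p)$ and for each $\phi\in\mathcal{L}(p)$, $\bigcap_{\psi\in\mathcal{B}(p)}[\![\psi]\!]\subseteq[\![\phi]\!]$; finitely characterized if moreover each $\mathcal{B}(p)$ is finite; $\mathcal{B}$ is monotonic iff $\mathcal{L}(p)\subseteq\mathcal{L}(q)$ implies $\mathcal{B}(p)\subseteq\mathcal{B}(q)$. Processes $p,q$ are incomparable iff neither $\mathcal{L}(p)\subseteq\mathcal{L}(q)$ nor $\mathcal{L}(q)\subseteq\mathcal{L}(p)$.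 A set $S\subseteq P$ represents $\phi$ iff its elements are pairwise incomparable and $[\![\phi]\!]=\bigcup_{p\in S}\uparrow p$; $\phi$ is finitely represented if represented by some finite $S$. -}

module Defs where

open import Data.Nat using (ℕ)
open import Data.Fin using (Fin)
open import Data.Product using (Σ; _×_; ∃)
open import Data.List using (List; [])
open import Data.List.Membership.Propositional using (_∈_)
open import Data.List.Relation.Unary.AllPairs using (AllPairs)
open import Relation.Binary.PropositionalEquality using (_≢_)
open import Relation.Nullary using (¬_)
open import Function.Bundles using (_⇔_)

-- A logic over the process set P = Fin n: a type of formulae L together with a
-- semantic function  ⟦_⟧ : L → 𝒫(P), where  ⟦ φ ⟧ p  means  p ∈ ⟦φ⟧.
module _ {n : ℕ} {L : Set} (⟦_⟧ : L → Fin n → Set) where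

  InL : Fin n → L → Set
  InL p φ = ⟦ φ ⟧ p

  _⊑_ : Fin n → Fin n → Set
  p ⊑ q = ∀ φ → InL p φ → InL q φ

  Up : Fin n → Fin n → Set
  Up p p' = p ⊑ p'

  FeaturesAnd : Set
  FeaturesAnd = ∀ φ ψ → Σ L λ χ → ∀ r → ⟦ χ ⟧ r ⇔ (⟦ φ ⟧ r × ⟦ ψ ⟧ r)

  -- 𝓛 is characterized by B, with each B(p) a finite set (given as a list),
  -- i.e. 𝓛 is finitely characterized by B.
  FinitelyCharacterizedBy : (Fin n → List L) → Set
  FinitelyCharacterizedBy B = ∀ p →
      (B p ≢ [])
    × (∀ ψ → ψ ∈ B p → InL p ψ)
    × (∀ φ → InL p φ → ∀ r → (∀ ψ → ψ ∈ B p → ⟦ ψ ⟧ r) → ⟦ φ ⟧ r)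

  Monotonic : (Fin n → List L) → Set
  Monotonic B = ∀ p q → p ⊑ q → ∀ ψ → ψ ∈ B p → ψ ∈ B q

  Incomparable : Fin n → Fin n → Set
  Incomparable p q = ¬ (p ⊑ q) × ¬ (q ⊑ p)

  Represents : List (Fin n) → L → Set
  Represents S φ =
      AllPairs Incomparable S
    × (∀ r → ⟦ φ ⟧ r ⇔ (∃ λ p → p ∈ S × Up p r))

  FinitelyRepresented : L → Set
  FinitelyRepresented φ = ∃ λ S → Represents S φ

{-# OPTIONS --safe #-}
module Submission where

-- (a) For every r with 𝓛(p) ⊈ 𝓛(r), pick a formula true at p and false at r: these
-- finitely many formulas rule out every such r, so they characterize p. Taking for q
-- the union of these sets over all p with 𝓛(p) ⊆ 𝓛(q) preserves this and makes the
-- choice monotonic. (b) ⟦φ⟧ is upward closed, hence the union of the cones ↑p of its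
-- finitely many elements. Inserting these one at a time, skipping an element whose cone
-- is already covered and discarding the elements above the new one, leaves pairwise
-- incomparable generators of the same cones. Excluded middle decides ⊑ and ⟦φ⟧.

open import Level using (0ℓ)
open import Axiom.ExcludedMiddle using (ExcludedMiddle)
open import Data.Empty using (⊥-elim)
open import Data.Nat using (ℕ; suc)
open import Data.Fin using (Fin)
open import Data.Product using (Σ; _×_; ∃; _,_; proj₁; proj₂)
open import Data.Sum using (_⊎_; inj₁; inj₂)
open import Data.Sum.Function.Propositional using (_⊎-⇔_)
open import Data.List using (List; []; _∷_; map; filter; foldr; concatMap; allFin)
open import Data.List.Relation.Unary.Any using (here; there; any?)
import Data.List.Relation.Unary.All as All
open import Data.List.Relation.Unary.AllPairs using (AllPairs; []; _∷_)
import Data.List.Relation.Unary.AllPairs.Properties as AllPairs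
open import Data.List.Relation.Binary.Subset.Propositional using (_⊆_)
open import Data.List.Membership.Propositional using (_∈_; find; lose)
open import Data.List.Membership.Propositional.Properties
  using (∈-map⁺; ∈-map⁻; ∈-filter⁺; ∈-filter⁻; ∈-concatMap⁺; ∈-concatMap⁻; ∈-allFin)
open import Relation.Nullary using (yes; no; ¬_; ¬?)
open import Relation.Nullary.Decidable using (map′; decidable-stable)
open import Relation.Binary.Core using (Rel)
open import Relation.Binary.Definitions using (Reflexive; Transitive; Decidable)
open import Relation.Binary.PropositionalEquality using (_≢_; refl)
import Relation.Binary.Reasoning.Setoid as ≈-Reasoning
open import Function.Base using (_∘_)
open import Function.Bundles using (_⇔_; mk⇔)
open import Function.Properties.Equivalence using (⇔-setoid)
open import Function.Construct.Identity using (⇔-id)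
open import Function.Construct.Symmetry using (⇔-sym)
open import Function.Construct.Composition using (_⇔-∘_)
open import Defs

∈⇒≢[] : {A : Set} {x : A} {xs : List A} → x ∈ xs → xs ≢ []
∈⇒≢[] (here _)  ()
∈⇒≢[] (there _) ()

⊆-≢[] : {A : Set} {xs ys : List A} → xs ⊆ ys → xs ≢ [] → ys ≢ []
⊆-≢[] {xs = []}    _     xs≢[] = ⊥-elim (xs≢[] refl)
⊆-≢[] {xs = _ ∷ _} xs⊆ys _     = ∈⇒≢[] (xs⊆ys (here refl))

module Antichain {A : Set} {_≤_ : Rel A 0ℓ} (≤-trans : Transitive _≤_) (_≤?_ : Decidable _≤_) where

  _∥_ : A → A → Set
  x ∥ y = ¬ x ≤ y × ¬ y ≤ x

  Covers : List A → A → Set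
  Covers S r = ∃ λ s → s ∈ S × s ≤ r

  covers? : Decidable Covers
  covers? S r = map′ find (λ (s , s∈S , s≤r) → lose s∈S s≤r) (any? (_≤? r) S)

  covers-∷ : ∀ {x S r} → Covers (x ∷ S) r ⇔ (x ≤ r ⊎ Covers S r)
  covers-∷ {x} {S} {r} = mk⇔ to from
    where
    to : Covers (x ∷ S) r → x ≤ r ⊎ Covers S r
    to (_ , here refl , x≤r) = inj₁ x≤r
    to (s , there s∈S , s≤r) = inj₂ (s , s∈S , s≤r)
    from : x ≤ r ⊎ Covers S r → Covers (x ∷ S) r
    from (inj₁ x≤r)             = x , here refl , x≤r
    from (inj₂ (s , s∈S , s≤r)) = s , there s∈S , s≤r

  notAbove : A → List A → List A
  notAbove x = filter (λ s → ¬? (x ≤? s))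

  insert : A → List A → List A
  insert x S with covers? S x
  ... | yes _ = S
  ... | no  _ = x ∷ notAbove x S

  insert-incomparable : ∀ x S → AllPairs _∥_ S → AllPairs _∥_ (insert x S)
  insert-incomparable x S S-incomparable with covers? S x
  ... | yes _         = S-incomparable
  ... | no  ¬covers-x = All.tabulate x∥ ∷ AllPairs.filter⁺ _ S-incomparable
    where
    x∥ : ∀ {s} → s ∈ notAbove x S → x ∥ s
    x∥ s∈ with s∈S , x≰s ← ∈-filter⁻ (λ s → ¬? (x ≤? s)) {xs = S} s∈
      = x≰s , λ s≤x → ¬covers-x (_ , s∈S , s≤x)

  insert-covers : ∀ x S {r} → Covers (insert x S) r ⇔ (x ≤ r ⊎ Covers S r)
  insert-covers x S {r} with covers? S x
  ... | yes (s , s∈S , s≤x) = mk⇔ inj₂ from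
    where
    from : x ≤ r ⊎ Covers S r → Covers S r
    from (inj₁ x≤r)    = s , s∈S , ≤-trans s≤x x≤r
    from (inj₂ covers) = covers
  ... | no _ = mk⇔ to from
    where
    to : Covers (x ∷ notAbove x S) r → x ≤ r ⊎ Covers S r
    to (_ , here refl , x≤r) = inj₁ x≤r
    to (s , there s∈ , s≤r)  = inj₂ (s , proj₁ (∈-filter⁻ (λ s → ¬? (x ≤? s)) {xs = S} s∈) , s≤r)
    from : x ≤ r ⊎ Covers S r → Covers (x ∷ notAbove x S) r
    from (inj₁ x≤r) = x , here refl , x≤r
    from (inj₂ (s , s∈S , s≤r)) with x ≤? s
    ... | yes x≤s = x , here refl , ≤-trans x≤s s≤r
    ... | no  x≰s = s , there (∈-filter⁺ (λ s → ¬? (x ≤? s)) s∈S x≰s) , s≤r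

  antichain : List A → List A
  antichain = foldr insert []

  antichain-incomparable : ∀ xs → AllPairs _∥_ (antichain xs)
  antichain-incomparable []       = []
  antichain-incomparable (x ∷ xs) = insert-incomparable x _ (antichain-incomparable xs)

  antichain-covers : ∀ xs {r} → Covers (antichain xs) r ⇔ Covers xs r
  antichain-covers []       = mk⇔ (λ ()) (λ ())
  antichain-covers (x ∷ xs) {r} = begin
    Covers (insert x (antichain xs)) r  ≈⟨ insert-covers x (antichain xs) ⟩
    (x ≤ r ⊎ Covers (antichain xs) r)   ≈⟨ ⇔-id _ ⊎-⇔ antichain-covers xs ⟩
    (x ≤ r ⊎ Covers xs r)               ≈⟨ covers-∷ ⟨
    Covers (x ∷ xs) r                   ∎
    where open ≈-Reasoning (⇔-setoid 0ℓ)

module Classical (em : ExcludedMiddle 0ℓ) {n : ℕ} {L : Set} (⟦_⟧ : L → Fin n → Set) where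

  _≼_ : Rel (Fin n) 0ℓ
  _≼_ = _⊑_ ⟦_⟧

  ≼-refl : Reflexive _≼_
  ≼-refl φ φ-holds = φ-holds

  ≼-trans : Transitive _≼_
  ≼-trans p≼q q≼r φ = q≼r φ ∘ p≼q φ

  _≼?_ : Decidable _≼_
  p ≼? q = em

  below : Fin n → List (Fin n)
  below q = filter (_≼? q) (allFin n)

  downUnion : (Fin n → List L) → Fin n → List L
  downUnion B q = concatMap B (below q)

  ∈-downUnion⁺ : ∀ {B p q ψ} → p ≼ q → ψ ∈ B p → ψ ∈ downUnion B q
  ∈-downUnion⁺ {B} {q = q} p≼q ψ∈Bp =
    ∈-concatMap⁺ B (lose (∈-filter⁺ (_≼? q) (∈-allFin _) p≼q) ψ∈Bp)

  ∈-downUnion⁻ : ∀ {B q ψ} → ψ ∈ downUnion B q → ∃ λ p → p ≼ q × ψ ∈ B p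
  ∈-downUnion⁻ {B} {q} ψ∈ with p , p∈ , ψ∈Bp ← find (∈-concatMap⁻ B {xs = below q} ψ∈) =
    p , proj₂ (∈-filter⁻ (_≼? q) {xs = allFin n} p∈) , ψ∈Bp

  downUnion-monotonic : ∀ B → Monotonic ⟦_⟧ (downUnion B)
  downUnion-monotonic B p q p≼q ψ ψ∈ with r , r≼p , ψ∈Br ← ∈-downUnion⁻ {B} ψ∈ =
    ∈-downUnion⁺ {B} (≼-trans r≼p p≼q) ψ∈Br

  ⊆-downUnion : ∀ {B} p → B p ⊆ downUnion B p
  ⊆-downUnion {B} p = ∈-downUnion⁺ {B} ≼-refl

  downUnion-sound : ∀ {B} → (∀ p ψ → ψ ∈ B p → ⟦ ψ ⟧ p) →
                    ∀ q ψ → ψ ∈ downUnion B q → ⟦ ψ ⟧ q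
  downUnion-sound {B} B-sound q ψ ψ∈ with p , p≼q , ψ∈Bp ← ∈-downUnion⁻ {B} ψ∈ =
    p≼q ψ (B-sound p ψ ψ∈Bp)

  downUnion-characterizes : ∀ {B} → FinitelyCharacterizedBy ⟦_⟧ B →
                            FinitelyCharacterizedBy ⟦_⟧ (downUnion B)
  downUnion-characterizes {B} B-characterizes p
    with B≢[] , _ , B-complete ← B-characterizes p =
      ⊆-≢[] (⊆-downUnion {B} p) B≢[]
    , downUnion-sound {B} (proj₁ ∘ proj₂ ∘ B-characterizes) p
    , λ φ φ-holds r all → B-complete φ φ-holds r (λ ψ → all ψ ∘ ⊆-downUnion {B} p)

  Separates : L → Fin n → Fin n → Set
  Separates φ p q = ⟦ φ ⟧ p × ¬ ⟦ φ ⟧ q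

  module Separation (inhabited : ∀ p → ∃ λ φ → ⟦ φ ⟧ p) where

    separator : Fin n → Fin n → L
    separator p q with em {∃ λ φ → Separates φ p q}
    ... | yes (φ , _) = φ
    ... | no  _       = proj₁ (inhabited p)

    separator-holds : ∀ p q → ⟦ separator p q ⟧ p
    separator-holds p q with em {∃ λ φ → Separates φ p q}
    ... | yes (_ , φ-holds , _) = φ-holds
    ... | no  _                 = proj₂ (inhabited p)

    separator-separates : ∀ {φ p q} → Separates φ p q → ¬ ⟦ separator p q ⟧ q
    separator-separates {φ} {p} {q} φ-separates with em {∃ λ φ → Separates φ p q}
    ... | yes (_ , _ , fails-q) = fails-q
    ... | no  ¬separable        = ⊥-elim (¬separable (φ , φ-separates))

    separators : Fin n → List L
    separators p = map (separator p) (allFin n)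

    separators-characterize : FinitelyCharacterizedBy ⟦_⟧ separators
    separators-characterize p = ∈⇒≢[] (separator∈ p) , sound , complete
      where
      separator∈ : ∀ q → separator p q ∈ separators p
      separator∈ q = ∈-map⁺ (separator p) (∈-allFin q)

      sound : ∀ ψ → ψ ∈ separators p → ⟦ ψ ⟧ p
      sound ψ ψ∈ with q , _ , refl ← ∈-map⁻ (separator p) ψ∈ = separator-holds p q

      complete : ∀ φ → ⟦ φ ⟧ p → ∀ r → (∀ ψ → ψ ∈ separators p → ⟦ ψ ⟧ r) → ⟦ φ ⟧ r
      complete φ φ-holds r all = decidable-stable em λ ¬φr →
        separator-separates (φ-holds , ¬φr) (all _ (separator∈ r))

  open Antichain ≼-trans _≼?_

  extension : L → List (Fin n)
  extension φ = filter (λ p → em {⟦ φ ⟧ p}) (allFin n)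

  extension-covers : ∀ φ {r} → Covers (extension φ) r ⇔ ⟦ φ ⟧ r
  extension-covers φ {r} = mk⇔ to from
    where
    to : Covers (extension φ) r → ⟦ φ ⟧ r
    to (p , p∈ , p≼r) = p≼r φ (proj₂ (∈-filter⁻ (λ p → em {⟦ φ ⟧ p}) {xs = allFin n} p∈))
    from : ⟦ φ ⟧ r → Covers (extension φ) r
    from φ-holds = r , ∈-filter⁺ (λ p → em {⟦ φ ⟧ p}) (∈-allFin r) φ-holds , ≼-refl

  finitelyRepresented : ∀ φ → FinitelyRepresented ⟦_⟧ φ
  finitelyRepresented φ =
    antichain (extension φ) ,
    antichain-incomparable (extension φ) ,
    λ r → ⇔-sym (extension-covers φ ⇔-∘ antichain-covers (extension φ))

mainTheorem17 : ExcludedMiddle 0ℓ →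
    (n : ℕ) (L : Set) (⟦_⟧ : L → Fin (suc n) → Set) →
    (∀ p → ∃ λ φ → ⟦ φ ⟧ p) →
    FeaturesAnd ⟦_⟧ →
    (Σ (Fin (suc n) → List L) λ B → FinitelyCharacterizedBy ⟦_⟧ B × Monotonic ⟦_⟧ B)
    × (∀ φ → FinitelyRepresented ⟦_⟧ φ)
mainTheorem17 em n L ⟦_⟧ inhabited _ =
    ( downUnion separators
    , downUnion-characterizes separators-characterize
    , downUnion-monotonic separators )
  , finitelyRepresented
  where
  open Classical em ⟦_⟧
  open Separation inhabited
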